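{- Let $f^{\mathrm{val}}(n,k)$ be the number of flattened permutations of length $n$ with exactly $k$ valleys. Define $b(n,k)$ by $b(0,0)=1$, $b(n,0)=n$ for $n\ge1$, and $b(n+1,k)=b(n,k)+\sum_{i=1}^{n-1}\binom{n}{i}b(i,k-1)$ for $n,k\ge1$ (with $b(0,k)=0$ for $k\ge1$). Then $f^{\mathrm{val}}(0,0)=1$ and $f^{\mathrm{val}}(n+1,k)=b(n,k)$ for $n,k\ge1$.
   Context: A permutation of $[n]$ is written $\pi=\pi_1\cdots\pi_n$; the empty permutation is included for $n=0$. A run is a maximal block of consecutive increasing entries. A permutation is flattened if the first entries of its runs, read from left to right, are increasing. A valley is an index $\ell$ with $2\le\ell\le n-1$ and $\pi_{\ell-1}>\pi_\ell<\pi_{\ell+1}$. -}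

module Defs where

open import Data.Nat using (ℕ; zero; suc; _+_; _*_; _∸_; _<_; _<ᵇ_)
open import Data.Nat.Combinatorics using (_C_)
open import Data.Bool using (Bool; true; false; if_then_else_; _∧_)
open import Data.List using (List; []; _∷_; map; upTo; length)
open import Data.Nat.ListAction using (sum)
open import Data.List.Relation.Binary.Permutation.Propositional using (_↭_)
open import Data.List.Relation.Unary.Linked using (Linked)
open import Data.List.Relation.Unary.Unique.Propositional using (Unique)
open import Data.List.Membership.Propositional using (_∈_)
open import Data.Product using (Σ; _×_)
open import Function.Bundles using (_⇔_)
open import Relation.Binary.PropositionalEquality using (_≡_)

IsPerm : ℕ → List ℕ → Set
IsPerm n π = π ↭ map suc (upTo n)

consHead : ℕ → List (List ℕ) → List (List ℕ)
consHead x []       = (x ∷ []) ∷ []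
consHead x (r ∷ rs) = (x ∷ r) ∷ rs

runs : List ℕ → List (List ℕ)
runs []           = []
runs (x ∷ [])     = (x ∷ []) ∷ []
runs (x ∷ y ∷ zs) = if x <ᵇ y then consHead x (runs (y ∷ zs))
                              else (x ∷ []) ∷ runs (y ∷ zs)

firsts : List (List ℕ) → List ℕ
firsts []             = []
firsts ([] ∷ rs)      = firsts rs
firsts ((x ∷ _) ∷ rs) = x ∷ firsts rs

Flattened : List ℕ → Set
Flattened π = Linked _<_ (firsts (runs π))

valleys : List ℕ → ℕ
valleys (x ∷ y ∷ z ∷ zs) =
  (if (y <ᵇ x) ∧ (y <ᵇ z) then 1 else 0) + valleys (y ∷ z ∷ zs)
valleys _ = 0

FlatVal : ℕ → ℕ → List ℕ → Set
FlatVal n k π = IsPerm n π × Flattened π × valleys π ≡ k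

NumberOf : (List ℕ → Set) → ℕ → Set
NumberOf P m = Σ (List (List ℕ)) λ L →
  Unique L × (∀ π → (π ∈ L) ⇔ P π) × length L ≡ m

-- b(n,k), defined by recursion on k (rows), then on n.
-- row 0: b(0,0)=1, b(n,0)=n for n ≥ 1
-- row k+1: b(0,k+1)=0,
--   b(n+1,k+1) = b(n,k+1) + Σ_{i=1}^{n-1} C(n,i) b(i,k)
bRow : ℕ → ℕ → ℕ
bRow zero zero    = 1
bRow zero (suc n) = suc n
bRow (suc k) = step
  where
  step : ℕ → ℕ
  step zero    = 0
  step (suc n) = step n + sum (map (λ i → (n C i) * bRow k i) (map suc (upTo (n ∸ 1))))

b : ℕ → ℕ → ℕ
b n k = bRow k n

-- Count flattened arrangements of any increasing list s₁ < s₂ < R rather than of [n]; each starts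
-- with s₁.  Either s₂ comes right after s₁, and deleting it keeps the arrangement flattened with the
-- same valleys (b(m,k) ways, m = |R|); or the first run is s₁ followed by a nonempty increasing
-- A ⊆ R, then s₂ opens the second run and is followed by an arrangement ρ′ of T = R ∖ A such that
-- s₂ ∷ ρ′ is flattened, the descent into s₂ adding a valley exactly when T ≠ ∅.  Enumerating the
-- pairs (A , T) as splits of R and grouping them by j = |T| gives
-- b(m+1,k) = b(m,k) + Σ_{j<m} C(m,j) · tailCount k j, the recurrence defining b.

module Submission where

open import Defs
open import Data.Bool using (true; false; if_then_else_)
open import Data.Bool.Properties using (T-≡)
open import Data.Empty using (⊥; ⊥-elim)
open import Data.List using (List; []; _∷_; map; length; _++_; upTo; applyUpTo)
open import Data.List.Properties
  using (++-assoc; length-++; length-map; length-applyUpTo; map-++; map-∘; map-applyUpTo;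
         ∷-injectiveˡ; ∷-injectiveʳ; ++-cancelˡ)
open import Data.List.Membership.Propositional using (_∈_; _∉_)
open import Data.List.Membership.Propositional.Properties
  using (∈-++⁻; ∈-++⁺ˡ; ∈-++⁺ʳ; ∈-map⁺; ∈-map⁻; ∈-∃++)
open import Data.List.Relation.Unary.All as All using (All; []; _∷_)
import Data.List.Relation.Unary.All.Properties as All
open import Data.List.Relation.Unary.AllPairs as AllPairs using (AllPairs; []; _∷_)
open import Data.List.Relation.Unary.Any using (here; there)
open import Data.List.Relation.Unary.Linked as Linked using (Linked; []; [-]; _∷_)
open import Data.List.Relation.Unary.Linked.Properties using (AllPairs⇒Linked; Linked⇒AllPairs)
open import Data.List.Relation.Unary.Unique.Propositional using (Unique)
import Data.List.Relation.Unary.Unique.Propositional.Properties as Unique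
import Data.List.Relation.Unary.AllPairs.Properties as AllPairs
open import Data.List.Relation.Binary.Permutation.Propositional
  using (_↭_; ↭-refl; ↭-sym; ↭-trans; ↭-prep; module PermutationReasoning)
open import Data.List.Relation.Binary.Permutation.Propositional.Properties
  using (∈-resp-↭; All-resp-↭; shift; drop-∷; ↭-empty-inv; ↭-singleton-inv; ++⁺ˡ; ↭-length)
open import Data.Nat using (ℕ; zero; suc; _+_; _*_; _<_; _≤_; _<ᵇ_; _≟_; s≤s)
open import Data.Nat.Properties
open import Data.Nat.Combinatorics using (_C_; nCk+nC[k+1]≡[n+1]C[k+1]; k>n⇒nCk≡0)
open import Data.Nat.Induction using (<-rec)
open import Data.Nat.ListAction using (sum)
open import Data.Nat.ListAction.Properties using (sum-++)
open import Data.Fin using (toℕ; inject₁; fromℕ)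
open import Data.Fin.Properties using (toℕ-inject₁; toℕ-fromℕ)
open import Algebra.Properties.CommutativeMonoid.Sum +-0-commutativeMonoid
  using (sum-syntax; ∑-distrib-+; sum-cong-≗; sum-init-last; sum-replicate-zero)
open import Algebra.Properties.CommutativeSemigroup +-commutativeSemigroup using (x∙yz≈xz∙y)
open import Data.Product using (Σ; ∃₂; _×_; _,_; proj₁; proj₂)
open import Data.Sum using (_⊎_; inj₁; inj₂)
open import Function using (_∘_; id)
open import Function.Bundles using (_⇔_; mk⇔; Equivalence)
open import Relation.Binary.PropositionalEquality
open import Relation.Nullary using (¬_; yes; no; contradiction)
open import Relation.Nullary.Reflects using (ofʸ)

open Equivalence using (to; from)

Sorted : List ℕ → Set
Sorted = AllPairs _<_

<ᵇ-true : ∀ {m n} → m < n → (m <ᵇ n) ≡ true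
<ᵇ-true = to T-≡ ∘ <⇒<ᵇ

<ᵇ-false : ∀ {m n} → ¬ m < n → (m <ᵇ n) ≡ false
<ᵇ-false {m} {n} m≮n with m <ᵇ n | <ᵇ-reflects-< m n
... | false | _       = refl
... | true  | ofʸ m<n = contradiction m<n m≮n

laterRunHeads : ℕ → List ℕ → List ℕ
laterRunHeads p []       = []
laterRunHeads p (y ∷ ys) = if p <ᵇ y then laterRunHeads y ys else y ∷ laterRunHeads y ys

runs-∷ : ∀ p xs → ∃₂ λ r rs → runs (p ∷ xs) ≡ (p ∷ r) ∷ rs × firsts rs ≡ laterRunHeads p xs
runs-∷ p []       = [] , [] , refl , refl
runs-∷ p (y ∷ ys) with runs-∷ y ys
... | r , rs , eq , heads with p <ᵇ y
... | true  rewrite eq = y ∷ r , rs , refl , heads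
... | false rewrite eq = [] , (y ∷ r) ∷ rs , refl , cong (y ∷_) heads

firsts-runs-∷ : ∀ p xs → firsts (runs (p ∷ xs)) ≡ p ∷ laterRunHeads p xs
firsts-runs-∷ p xs with runs-∷ p xs
... | r , rs , eq , heads rewrite eq = cong (p ∷_) heads

Flattened-∷ : ∀ p xs → Flattened (p ∷ xs) ⇔ Linked _<_ (p ∷ laterRunHeads p xs)
Flattened-∷ p xs = mk⇔ (subst (Linked _<_) eq) (subst (Linked _<_) (sym eq))
  where eq = firsts-runs-∷ p xs

laterRunHeads-ascent : ∀ {p y} ys → p < y → laterRunHeads p (y ∷ ys) ≡ laterRunHeads y ys
laterRunHeads-ascent {p} {y} ys p<y rewrite <ᵇ-true p<y = refl

laterRunHeads-descent : ∀ {p y} ys → ¬ p < y → laterRunHeads p (y ∷ ys) ≡ y ∷ laterRunHeads y ys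
laterRunHeads-descent {p} {y} ys p≮y rewrite <ᵇ-false p≮y = refl

lastOf : ℕ → List ℕ → ℕ
lastOf q []      = q
lastOf q (a ∷ A) = lastOf a A

lastOf-∈ : ∀ q A → lastOf q A ∈ q ∷ A
lastOf-∈ q []      = here refl
lastOf-∈ q (a ∷ A) = there (lastOf-∈ a A)

laterRunHeads-++ : ∀ q A ys → Linked _<_ (q ∷ A) →
                   laterRunHeads q (A ++ ys) ≡ laterRunHeads (lastOf q A) ys
laterRunHeads-++ q []      ys _           = refl
laterRunHeads-++ q (a ∷ A) ys (q<a ∷ asc) =
  trans (laterRunHeads-ascent (A ++ ys) q<a) (laterRunHeads-++ a A ys asc)

-- Each entry of xs either continues the run of p ≥ f or is at least the head of its own run.
laterRunHeads-above : ∀ {f p} xs → f ≤ p → Linked _<_ (f ∷ laterRunHeads p xs) → All (f <_) xs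
laterRunHeads-above []       f≤p heads = []
laterRunHeads-above {f} {p} (y ∷ ys) f≤p heads with p <? y
... | yes p<y =
  f<y ∷ laterRunHeads-above ys (<⇒≤ f<y) (subst (Linked _<_ ∘ (f ∷_)) (laterRunHeads-ascent ys p<y) heads)
  where f<y = <-≤-trans (s≤s f≤p) p<y
... | no p≮y with subst (Linked _<_ ∘ (f ∷_)) (laterRunHeads-descent ys p≮y) heads
...   | f<y ∷ heads′ = f<y ∷ All.map (<-trans f<y) (laterRunHeads-above ys ≤-refl heads′)

Flattened⇒head-least : ∀ p xs → Flattened (p ∷ xs) → All (p <_) xs
Flattened⇒head-least p xs fl = laterRunHeads-above xs ≤-refl (to (Flattened-∷ p xs) fl)

valleys-ascent : ∀ {q a} zs → q < a → valleys (q ∷ a ∷ zs) ≡ valleys (a ∷ zs)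
valleys-ascent         []       _   = refl
valleys-ascent {q} {a} (z ∷ zs) q<a rewrite <ᵇ-false {a} {q} (<⇒≯ q<a) = refl

risesFrom : ℕ → List ℕ → ℕ
risesFrom s []      = 0
risesFrom s (r ∷ _) = if s <ᵇ r then 1 else 0

risesFrom-above : ∀ {s r ρ} → s < r → risesFrom s (r ∷ ρ) ≡ 1
risesFrom-above s<r rewrite <ᵇ-true s<r = refl

valleys-run-++ : ∀ q A s ρ → Linked _<_ (q ∷ A) → s < lastOf q A →
                 valleys (q ∷ A ++ s ∷ ρ) ≡ valleys (s ∷ ρ) + risesFrom s ρ
valleys-run-++ q []      s []      _ _ = refl
valleys-run-++ q []      s (r ∷ ρ) _ s<q rewrite <ᵇ-true s<q =
  +-comm (risesFrom s (r ∷ ρ)) (valleys (s ∷ r ∷ ρ))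
valleys-run-++ q (a ∷ A) s ρ (q<a ∷ asc) s<last =
  trans (valleys-ascent (A ++ s ∷ ρ) q<a) (valleys-run-++ a A s ρ asc s<last)

NumberOf-resp-⇔ : ∀ {P Q : List ℕ → Set} {m} → (∀ π → P π ⇔ Q π) → NumberOf P m → NumberOf Q m
NumberOf-resp-⇔ P⇔Q (L , unique , mem , len) =
  L , unique , (λ π → mk⇔ (to (P⇔Q π) ∘ to (mem π)) (from (mem π) ∘ from (P⇔Q π))) , len

NumberOf-∅ : ∀ {P : List ℕ → Set} → (∀ π → ¬ P π) → NumberOf P 0
NumberOf-∅ ¬P = [] , [] , (λ π → mk⇔ (λ ()) (⊥-elim ∘ ¬P π)) , refl

NumberOf-≡ : ∀ x → NumberOf (_≡ x) 1
NumberOf-≡ x = x ∷ [] , [] ∷ [] , (λ π → mk⇔ (λ { (here eq) → eq ; (there ()) }) here) , refl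

NumberOf-⊎ : ∀ {P Q : List ℕ → Set} {a b} → (∀ π → P π → ¬ Q π) →
             NumberOf P a → NumberOf Q b → NumberOf (λ π → P π ⊎ Q π) (a + b)
NumberOf-⊎ {P} {Q} disjoint (L₁ , u₁ , m₁ , l₁) (L₂ , u₂ , m₂ , l₂) =
  L₁ ++ L₂ ,
  Unique.++⁺ u₁ u₂ (λ (i₁ , i₂) → disjoint _ (to (m₁ _) i₁) (to (m₂ _) i₂)) ,
  (λ π → mk⇔ (to′ π) (from′ π)) ,
  trans (length-++ L₁) (cong₂ _+_ l₁ l₂)
  where
  to′ : ∀ π → π ∈ L₁ ++ L₂ → P π ⊎ Q π
  to′ π i with ∈-++⁻ L₁ i
  ... | inj₁ i₁ = inj₁ (to (m₁ π) i₁)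
  ... | inj₂ i₂ = inj₂ (to (m₂ π) i₂)
  from′ : ∀ π → P π ⊎ Q π → π ∈ L₁ ++ L₂
  from′ π (inj₁ p) = ∈-++⁺ˡ (from (m₁ π) p)
  from′ π (inj₂ q) = ∈-++⁺ʳ L₁ (from (m₂ π) q)

NumberOf-image : ∀ {P : List ℕ → Set} {a} (f : List ℕ → List ℕ) → (∀ {x y} → f x ≡ f y → x ≡ y) →
                 NumberOf P a → NumberOf (λ π → Σ (List ℕ) λ σ → P σ × π ≡ f σ) a
NumberOf-image {P} f f-injective (L , unique , mem , len) =
  map f L , Unique.map⁺ f-injective unique , (λ π → mk⇔ (to′ π) (from′ π)) , trans (length-map f L) len
  where
  to′ : ∀ π → π ∈ map f L → Σ (List ℕ) λ σ → P σ × π ≡ f σ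
  to′ π i with ∈-map⁻ f i
  ... | σ , σ∈L , eq = σ , to (mem σ) σ∈L , eq
  from′ : ∀ π → (Σ (List ℕ) λ σ → P σ × π ≡ f σ) → π ∈ map f L
  from′ π (σ , p , refl) = ∈-map⁺ f (from (mem σ) p)

NumberOf-⋃ : ∀ {I : Set} (P : I → List ℕ → Set) (count : I → ℕ) (xs : List I) → Unique xs →
             (∀ i j π → i ∈ xs → j ∈ xs → P i π → P j π → i ≡ j) →
             (∀ i → i ∈ xs → NumberOf (P i) (count i)) →
             NumberOf (λ π → Σ I λ i → i ∈ xs × P i π) (sum (map count xs))
NumberOf-⋃ P count []       _             _        _      = NumberOf-∅ λ { π (i , () , _) }
NumberOf-⋃ {I} P count (x ∷ xs) (x∉xs ∷ unique) disjoint counted =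
  NumberOf-resp-⇔ reindex
    (NumberOf-⊎ disjoint-x (counted x (here refl))
      (NumberOf-⋃ P count xs unique (λ i j π i∈ j∈ → disjoint i j π (there i∈) (there j∈))
                                    (λ i i∈ → counted i (there i∈))))
  where
  disjoint-x : ∀ π → P x π → ¬ (Σ I λ i → i ∈ xs × P i π)
  disjoint-x π p (i , i∈ , q) = All.lookup x∉xs i∈ (disjoint x i π (here refl) (there i∈) p q)
  reindex : ∀ π → (P x π ⊎ (Σ I λ i → i ∈ xs × P i π)) ⇔ (Σ I λ i → i ∈ x ∷ xs × P i π)
  reindex π = mk⇔ (λ { (inj₁ p) → x , here refl , p ; (inj₂ (i , i∈ , q)) → i , there i∈ , q })
                  (λ { (_ , here refl , p) → inj₁ p ; (i , there i∈ , q) → inj₂ (i , i∈ , q) })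

∑-snoc : ∀ m (f : ℕ → ℕ) → ∑[ j < suc m ] f (toℕ j) ≡ ∑[ j < m ] f (toℕ j) + f m
∑-snoc m f = begin
  ∑[ j < suc m ] f (toℕ j)                            ≡⟨ sum-init-last {m} (f ∘ toℕ) ⟩
  ∑[ j < m ] f (toℕ (inject₁ j)) + f (toℕ (fromℕ m))
    ≡⟨ cong₂ _+_ (sum-cong-≗ {m} (cong f ∘ toℕ-inject₁)) (cong f (toℕ-fromℕ m)) ⟩
  ∑[ j < m ] f (toℕ j) + f m                          ∎
  where open ≡-Reasoning

binomialTerm : ℕ → (ℕ → ℕ) → ℕ → ℕ
binomialTerm m φ i = (m C i) * φ i

binomialSum : ℕ → (ℕ → ℕ) → ℕ
binomialSum m φ = ∑[ i < suc m ] binomialTerm m φ (toℕ i)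

properBinomialSum : ℕ → (ℕ → ℕ) → ℕ
properBinomialSum m φ = ∑[ i < m ] binomialTerm m φ (toℕ i)

binomialTerm-pascal : ∀ m φ i →
  binomialTerm (suc m) φ (suc i) ≡ binomialTerm m (φ ∘ suc) i + binomialTerm m φ (suc i)
binomialTerm-pascal m φ i = begin
  (suc m C suc i) * φ (suc i)                   ≡⟨ cong (_* φ (suc i)) (nCk+nC[k+1]≡[n+1]C[k+1] m i) ⟨
  (m C i + m C suc i) * φ (suc i)               ≡⟨ *-distribʳ-+ (φ (suc i)) (m C i) (m C suc i) ⟩
  (m C i) * φ (suc i) + (m C suc i) * φ (suc i) ∎
  where open ≡-Reasoning

∑-pascal : ∀ m n (φ : ℕ → ℕ) →
  ∑[ j < n ] binomialTerm (suc m) φ (suc (toℕ j)) ≡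
  ∑[ j < n ] binomialTerm m (φ ∘ suc) (toℕ j) + ∑[ j < n ] binomialTerm m φ (suc (toℕ j))
∑-pascal m n φ = trans (sum-cong-≗ {n} (binomialTerm-pascal m φ ∘ toℕ)) (∑-distrib-+ {n} _ _)

∑-binomialTerm-beyond : ∀ m φ →
  ∑[ j < suc m ] binomialTerm m φ (suc (toℕ j)) ≡ ∑[ j < m ] binomialTerm m φ (suc (toℕ j))
∑-binomialTerm-beyond m φ = begin
  ∑[ j < suc m ] binomialTerm m φ (suc (toℕ j))            ≡⟨ ∑-snoc m (binomialTerm m φ ∘ suc) ⟩
  ∑[ j < m ] binomialTerm m φ (suc (toℕ j)) + (m C suc m) * φ (suc m)
    ≡⟨ cong (λ c → ∑[ j < m ] binomialTerm m φ (suc (toℕ j)) + c * φ (suc m)) (k>n⇒nCk≡0 (n<1+n m)) ⟩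
  ∑[ j < m ] binomialTerm m φ (suc (toℕ j)) + 0            ≡⟨ +-identityʳ _ ⟩
  ∑[ j < m ] binomialTerm m φ (suc (toℕ j))                ∎
  where open ≡-Reasoning

binomialSum-suc : ∀ m φ → binomialSum (suc m) φ ≡ binomialSum m φ + binomialSum m (φ ∘ suc)
binomialSum-suc m φ = begin
  binomialTerm (suc m) φ 0 + ∑[ j < suc m ] binomialTerm (suc m) φ (suc (toℕ j))
    ≡⟨ cong (binomialTerm (suc m) φ 0 +_) (∑-pascal m (suc m) φ) ⟩
  binomialTerm m φ 0 + (binomialSum m (φ ∘ suc) + ∑[ j < suc m ] binomialTerm m φ (suc (toℕ j)))
    ≡⟨ cong (λ s → binomialTerm m φ 0 + (binomialSum m (φ ∘ suc) + s)) (∑-binomialTerm-beyond m φ) ⟩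
  binomialTerm m φ 0 + (binomialSum m (φ ∘ suc) + ∑[ j < m ] binomialTerm m φ (suc (toℕ j)))
    ≡⟨ x∙yz≈xz∙y (binomialTerm m φ 0) (binomialSum m (φ ∘ suc)) _ ⟩
  binomialSum m φ + binomialSum m (φ ∘ suc) ∎
  where open ≡-Reasoning

properBinomialSum-suc : ∀ m φ →
  properBinomialSum (suc m) φ ≡ binomialSum m φ + properBinomialSum m (φ ∘ suc)
properBinomialSum-suc m φ = begin
  binomialTerm (suc m) φ 0 + ∑[ j < m ] binomialTerm (suc m) φ (suc (toℕ j))
    ≡⟨ cong (binomialTerm (suc m) φ 0 +_) (∑-pascal m m φ) ⟩
  binomialTerm m φ 0 + (properBinomialSum m (φ ∘ suc) + ∑[ j < m ] binomialTerm m φ (suc (toℕ j)))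
    ≡⟨ x∙yz≈xz∙y (binomialTerm m φ 0) (properBinomialSum m (φ ∘ suc)) _ ⟩
  binomialSum m φ + properBinomialSum m (φ ∘ suc) ∎
  where open ≡-Reasoning

Split : Set
Split = List ℕ × List ℕ

consˡ consʳ : ℕ → Split → Split
consˡ x (A , T) = x ∷ A , T
consʳ x (A , T) = A , x ∷ T

splits : List ℕ → List Split
splits []      = ([] , []) ∷ []
splits (x ∷ R) = map (consˡ x) (splits R) ++ map (consʳ x) (splits R)

splits⁺ : List ℕ → List Split
splits⁺ []      = []
splits⁺ (x ∷ R) = map (consˡ x) (splits R) ++ map (consʳ x) (splits⁺ R)

sizeOfSecond : (ℕ → ℕ) → Split → ℕ
sizeOfSecond φ (_ , T) = φ (length T)

sum-sizeOfSecond-∷ : ∀ φ x xs ys →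
  sum (map (sizeOfSecond φ) (map (consˡ x) xs ++ map (consʳ x) ys)) ≡
  sum (map (sizeOfSecond φ) xs) + sum (map (sizeOfSecond (φ ∘ suc)) ys)
sum-sizeOfSecond-∷ φ x xs ys = begin
  sum (map h (map (consˡ x) xs ++ map (consʳ x) ys))
    ≡⟨ cong sum (map-++ h (map (consˡ x) xs) _) ⟩
  sum (map h (map (consˡ x) xs) ++ map h (map (consʳ x) ys))
    ≡⟨ sum-++ (map h (map (consˡ x) xs)) _ ⟩
  sum (map h (map (consˡ x) xs)) + sum (map h (map (consʳ x) ys))
    ≡⟨ cong₂ _+_ (cong sum (map-∘ xs)) (cong sum (map-∘ ys)) ⟨
  sum (map (sizeOfSecond φ) xs) + sum (map (sizeOfSecond (φ ∘ suc)) ys) ∎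
  where
  open ≡-Reasoning
  h = sizeOfSecond φ

sum-splits : ∀ R φ → sum (map (sizeOfSecond φ) (splits R)) ≡ binomialSum (length R) φ
sum-splits []      φ = cong (_+ 0) (sym (*-identityˡ (φ 0)))
sum-splits (x ∷ R) φ = begin
  sum (map (sizeOfSecond φ) (splits (x ∷ R)))
    ≡⟨ sum-sizeOfSecond-∷ φ x (splits R) (splits R) ⟩
  sum (map (sizeOfSecond φ) (splits R)) + sum (map (sizeOfSecond (φ ∘ suc)) (splits R))
    ≡⟨ cong₂ _+_ (sum-splits R φ) (sum-splits R (φ ∘ suc)) ⟩
  binomialSum (length R) φ + binomialSum (length R) (φ ∘ suc)
    ≡⟨ binomialSum-suc (length R) φ ⟨
  binomialSum (suc (length R)) φ ∎
  where open ≡-Reasoning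

sum-splits⁺ : ∀ R φ → sum (map (sizeOfSecond φ) (splits⁺ R)) ≡ properBinomialSum (length R) φ
sum-splits⁺ []      φ = refl
sum-splits⁺ (x ∷ R) φ = begin
  sum (map (sizeOfSecond φ) (splits⁺ (x ∷ R)))
    ≡⟨ sum-sizeOfSecond-∷ φ x (splits R) (splits⁺ R) ⟩
  sum (map (sizeOfSecond φ) (splits R)) + sum (map (sizeOfSecond (φ ∘ suc)) (splits⁺ R))
    ≡⟨ cong₂ _+_ (sum-splits R φ) (sum-splits⁺ R (φ ∘ suc)) ⟩
  binomialSum (length R) φ + properBinomialSum (length R) (φ ∘ suc)
    ≡⟨ properBinomialSum-suc (length R) φ ⟨
  properBinomialSum (suc (length R)) φ ∎
  where open ≡-Reasoning

data SplitOrigin (x : ℕ) (xs ys : List Split) : Split → Set where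
  left  : ∀ {A T} → (A , T) ∈ xs → SplitOrigin x xs ys (x ∷ A , T)
  right : ∀ {A T} → (A , T) ∈ ys → SplitOrigin x xs ys (A , x ∷ T)

splitOrigin : ∀ x xs ys {p} → p ∈ map (consˡ x) xs ++ map (consʳ x) ys → SplitOrigin x xs ys p
splitOrigin x xs ys p∈ with ∈-++⁻ (map (consˡ x) xs) p∈
... | inj₁ p∈ˡ with ∈-map⁻ (consˡ x) p∈ˡ
...   | _ , q∈ , refl = left q∈
splitOrigin x xs ys p∈ | inj₂ p∈ʳ with ∈-map⁻ (consʳ x) p∈ʳ
...   | _ , q∈ , refl = right q∈

left-∈ : ∀ x {xs ys A T} → (A , T) ∈ xs → (x ∷ A , T) ∈ map (consˡ x) xs ++ map (consʳ x) ys
left-∈ x q∈ = ∈-++⁺ˡ (∈-map⁺ (consˡ x) q∈)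

right-∈ : ∀ x {xs ys A T} → (A , T) ∈ ys → (A , x ∷ T) ∈ map (consˡ x) xs ++ map (consʳ x) ys
right-∈ x {xs} q∈ = ∈-++⁺ʳ (map (consˡ x) xs) (∈-map⁺ (consʳ x) q∈)

splits-↭ : ∀ R {A T} → (A , T) ∈ splits R → A ++ T ↭ R
splits-↭ []      (here refl) = ↭-refl
splits-↭ (x ∷ R) p∈ with splitOrigin x (splits R) (splits R) p∈
... | left  q∈ = ↭-prep x (splits-↭ R q∈)
... | right {A} {T} q∈ = ↭-trans (shift x A T) (↭-prep x (splits-↭ R q∈))

splits⁺⊆splits : ∀ R {p} → p ∈ splits⁺ R → p ∈ splits R
splits⁺⊆splits (x ∷ R) p∈ with splitOrigin x (splits R) (splits⁺ R) p∈
... | left  q∈ = left-∈ x q∈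
... | right q∈ = right-∈ x (splits⁺⊆splits R q∈)

splits⁺-nonempty : ∀ R {A T} → (A , T) ∈ splits⁺ R → Σ ℕ λ a → Σ (List ℕ) λ A′ → A ≡ a ∷ A′
splits⁺-nonempty (x ∷ R) p∈ with splitOrigin x (splits R) (splits⁺ R) p∈
... | left {A} q∈ = x , A , refl
... | right q∈ = splits⁺-nonempty R q∈

splits⇒splits⁺ : ∀ R {a A T} → (a ∷ A , T) ∈ splits R → (a ∷ A , T) ∈ splits⁺ R
splits⇒splits⁺ []      (here ())
splits⇒splits⁺ (x ∷ R) p∈ with splitOrigin x (splits R) (splits R) p∈
... | left  q∈ = left-∈ x q∈
... | right q∈ = right-∈ x (splits⇒splits⁺ R q∈)

All-splits : ∀ {P : ℕ → Set} R {A T} → All P R → (A , T) ∈ splits R → All P A × All P T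
All-splits R {A} all p∈ = All.++⁻ A (All-resp-↭ (↭-sym (splits-↭ R p∈)) all)

<-∉ : ∀ {x xs} → All (x <_) xs → x ∉ xs
<-∉ x<xs x∈ = <-irrefl refl (All.lookup x<xs x∈)

splits-sorted : ∀ R {A T} → Sorted R → (A , T) ∈ splits R → Sorted A × Sorted T
splits-sorted []      _              (here refl) = [] , []
splits-sorted (x ∷ R) (x<R ∷ sorted) p∈ with splitOrigin x (splits R) (splits R) p∈
... | left  q∈ = let (sA , sT) = splits-sorted R sorted q∈ in proj₁ (All-splits R x<R q∈) ∷ sA , sT
... | right q∈ = let (sA , sT) = splits-sorted R sorted q∈ in sA , proj₂ (All-splits R x<R q∈) ∷ sT

splits-second-unique : ∀ R {A T T′} → Sorted R → (A , T) ∈ splits R → (A , T′) ∈ splits R → T ≡ T′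
splits-second-unique []      _              (here refl) (here refl) = refl
splits-second-unique (x ∷ R) (x<R ∷ sorted) p∈ p′∈ =
  compare (splitOrigin x (splits R) (splits R) p∈) (splitOrigin x (splits R) (splits R) p′∈)
  where
  compare : ∀ {A T T′} → SplitOrigin x (splits R) (splits R) (A , T) →
            SplitOrigin x (splits R) (splits R) (A , T′) → T ≡ T′
  compare (left  q∈) (left  q′∈) = splits-second-unique R sorted q∈ q′∈
  compare (left  q∈) (right q′∈) = ⊥-elim (<-∉ (proj₁ (All-splits R x<R q′∈)) (here refl))
  compare (right q∈) (left  q′∈) = ⊥-elim (<-∉ (proj₁ (All-splits R x<R q∈)) (here refl))
  compare (right q∈) (right q′∈) = cong (x ∷_) (splits-second-unique R sorted q∈ q′∈)

Unique-splitOrigins : ∀ x (xs ys : List Split) → Unique xs → Unique ys →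
                      (∀ {A T} → (A , T) ∈ ys → x ∉ A) → Unique (map (consˡ x) xs ++ map (consʳ x) ys)
Unique-splitOrigins x xs ys uxs uys x∉ =
  Unique.++⁺ (Unique.map⁺ consˡ-injective uxs) (Unique.map⁺ consʳ-injective uys) disjoint
  where
  consˡ-injective : ∀ {p q : Split} → consˡ x p ≡ consˡ x q → p ≡ q
  consˡ-injective {_ , _} {_ , _} refl = refl
  consʳ-injective : ∀ {p q : Split} → consʳ x p ≡ consʳ x q → p ≡ q
  consʳ-injective {_ , _} {_ , _} refl = refl
  disjoint : ∀ {p} → ¬ (p ∈ map (consˡ x) xs × p ∈ map (consʳ x) ys)
  disjoint (p∈ˡ , p∈ʳ) with ∈-map⁻ (consˡ x) p∈ˡ | ∈-map⁻ (consʳ x) p∈ʳ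
  ... | _ , _ , refl | _ , q∈ , eq = x∉ q∈ (subst (x ∈_) (cong proj₁ eq) (here refl))

splits-unique : ∀ R → Sorted R → Unique (splits R)
splits-unique []      _              = [] ∷ []
splits-unique (x ∷ R) (x<R ∷ sorted) =
  Unique-splitOrigins x (splits R) (splits R) (splits-unique R sorted) (splits-unique R sorted)
    (<-∉ ∘ proj₁ ∘ All-splits R x<R)

splits⁺-unique : ∀ R → Sorted R → Unique (splits⁺ R)
splits⁺-unique []      _              = []
splits⁺-unique (x ∷ R) (x<R ∷ sorted) =
  Unique-splitOrigins x (splits R) (splits⁺ R) (splits-unique R sorted) (splits⁺-unique R sorted)
    (<-∉ ∘ proj₁ ∘ All-splits R x<R ∘ splits⁺⊆splits R)

least-unique : ∀ {x a R A} → All (x <_) R → All (a <_) A → x ∈ a ∷ A → a ∈ x ∷ R → a ≡ x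
least-unique _   _   (here x≡a)  _           = sym x≡a
least-unique _   _   (there _)   (here a≡x)  = a≡x
least-unique x<R a<A (there x∈A) (there a∈R) =
  ⊥-elim (<-asym (All.lookup a<A x∈A) (All.lookup x<R a∈R))

↭-remove : ∀ (x : ℕ) (A X₁ X₂ : List ℕ) {R} → A ++ X₁ ++ x ∷ X₂ ↭ x ∷ R → A ++ X₁ ++ X₂ ↭ R
↭-remove x A X₁ X₂ {R} p = drop-∷ (begin
  x ∷ A ++ X₁ ++ X₂      ≡⟨ cong (x ∷_) (++-assoc A X₁ X₂) ⟨
  x ∷ (A ++ X₁) ++ X₂    ↭⟨ shift x (A ++ X₁) X₂ ⟨
  (A ++ X₁) ++ x ∷ X₂    ≡⟨ ++-assoc A X₁ (x ∷ X₂) ⟩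
  A ++ X₁ ++ x ∷ X₂      ↭⟨ p ⟩
  x ∷ R                  ∎)
  where open PermutationReasoning

sorted-sublist-∈-splits : ∀ R A X → Sorted R → Sorted A → A ++ X ↭ R →
                          Σ (List ℕ) λ T → (A , T) ∈ splits R × X ↭ T
sorted-sublist-∈-splits [] A X _ _ p with ↭-empty-inv p
sorted-sublist-∈-splits [] [] [] _ _ _ | refl = [] , here refl , ↭-refl
sorted-sublist-∈-splits (x ∷ R) A X (x<R ∷ sorted) sortedA p
  with ∈-++⁻ A (∈-resp-↭ (↭-sym p) (here refl))
sorted-sublist-∈-splits (x ∷ R) (a ∷ A) X (x<R ∷ sorted) (a<A ∷ sortedA) p | inj₁ x∈aA
  with least-unique x<R a<A x∈aA (∈-resp-↭ p (here refl))
... | refl with sorted-sublist-∈-splits R A X sorted sortedA (drop-∷ p)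
...   | T , q∈ , X↭T = T , left-∈ x q∈ , X↭T
sorted-sublist-∈-splits (x ∷ R) A X (x<R ∷ sorted) sortedA p | inj₂ x∈X with ∈-∃++ x∈X
... | X₁ , X₂ , refl
  with sorted-sublist-∈-splits R A (X₁ ++ X₂) sorted sortedA (↭-remove x A X₁ X₂ p)
...   | T , q∈ , X↭T = x ∷ T , right-∈ x q∈ , ↭-trans (shift x X₁ X₂) (↭-prep x X↭T)

FlatArrangement : List ℕ → ℕ → List ℕ → Set
FlatArrangement S k π = π ↭ S × Flattened π × valleys π ≡ k

flattened-starts-least : ∀ s S π → Sorted (s ∷ S) → π ↭ s ∷ S → Flattened π →
                         Σ (List ℕ) λ π′ → π ≡ s ∷ π′ × All (s <_) π′
flattened-starts-least s S []      _          p _ with ∈-resp-↭ (↭-sym p) (here refl)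
... | ()
flattened-starts-least s S (q ∷ π′) (s<S ∷ _) p flat
  with least-unique s<S q<π′ (∈-resp-↭ (↭-sym p) (here refl)) (∈-resp-↭ p (here refl))
  where q<π′ = Flattened⇒head-least q π′ flat
... | refl = π′ , refl , Flattened⇒head-least q π′ flat

module _ {s₁ s₂ : ℕ} (s₁<s₂ : s₁ < s₂) where

  laterRunHeads-skip : ∀ σ → All (s₂ <_) σ → laterRunHeads s₁ (s₂ ∷ σ) ≡ laterRunHeads s₁ σ
  laterRunHeads-skip []      _          = laterRunHeads-ascent [] s₁<s₂
  laterRunHeads-skip (y ∷ σ) (s₂<y ∷ _) = begin
    laterRunHeads s₁ (s₂ ∷ y ∷ σ) ≡⟨ laterRunHeads-ascent (y ∷ σ) s₁<s₂ ⟩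
    laterRunHeads s₂ (y ∷ σ)      ≡⟨ laterRunHeads-ascent σ s₂<y ⟩
    laterRunHeads y σ             ≡⟨ laterRunHeads-ascent σ (<-trans s₁<s₂ s₂<y) ⟨
    laterRunHeads s₁ (y ∷ σ)      ∎
    where open ≡-Reasoning

  valleys-skip : ∀ σ → All (s₂ <_) σ → valleys (s₁ ∷ s₂ ∷ σ) ≡ valleys (s₁ ∷ σ)
  valleys-skip []      _          = refl
  valleys-skip (y ∷ σ) (s₂<y ∷ _) = begin
    valleys (s₁ ∷ s₂ ∷ y ∷ σ) ≡⟨ valleys-ascent (y ∷ σ) s₁<s₂ ⟩
    valleys (s₂ ∷ y ∷ σ)      ≡⟨ valleys-ascent σ s₂<y ⟩
    valleys (y ∷ σ)           ≡⟨ valleys-ascent σ (<-trans s₁<s₂ s₂<y) ⟨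
    valleys (s₁ ∷ y ∷ σ)      ∎
    where open ≡-Reasoning

  Flattened-skip : ∀ σ → All (s₂ <_) σ → Flattened (s₁ ∷ s₂ ∷ σ) ⇔ Flattened (s₁ ∷ σ)
  Flattened-skip σ s₂<σ = mk⇔
    (from (Flattened-∷ s₁ σ) ∘ subst (Linked _<_ ∘ (s₁ ∷_)) skip ∘ to (Flattened-∷ s₁ (s₂ ∷ σ)))
    (from (Flattened-∷ s₁ (s₂ ∷ σ)) ∘ subst (Linked _<_ ∘ (s₁ ∷_)) (sym skip) ∘ to (Flattened-∷ s₁ σ))
    where skip = laterRunHeads-skip σ s₂<σ

insertSecond : ℕ → List ℕ → List ℕ
insertSecond s []      = []
insertSecond s (x ∷ σ) = x ∷ s ∷ σ

insertSecond-injective : ∀ s {σ τ} → insertSecond s σ ≡ insertSecond s τ → σ ≡ τ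
insertSecond-injective s {[]}    {[]}    _    = refl
insertSecond-injective s {_ ∷ _} {_ ∷ _} refl = refl

-- The endings s ∷ ρ′ of a flattened arrangement with k valleys in which s follows a descent and ρ′
-- arranges T.  The descent into s is a valley exactly when T is nonempty, so then s ∷ ρ′ must
-- carry the remaining k - 1 valleys.
TailOf : ℕ → ℕ → List ℕ → List ℕ → Set
TailOf s k       []      ρ = ρ ≡ s ∷ [] × k ≡ 0
TailOf s zero    (_ ∷ _) ρ = ⊥
TailOf s (suc k) (t ∷ T) ρ = FlatArrangement (s ∷ t ∷ T) k ρ

risesFrom-↭ : ∀ {s t T ρ} → All (s <_) ρ → ρ ↭ t ∷ T → risesFrom s ρ ≡ 1
risesFrom-↭ {ρ = []}    _          p with ↭-empty-inv (↭-sym p)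
... | ()
risesFrom-↭ {ρ = _ ∷ ρ} (s<r ∷ _) _ = risesFrom-above {ρ = ρ} s<r

TailOf-shape : ∀ s k T ρ → Sorted (s ∷ T) → TailOf s k T ρ →
               Σ (List ℕ) λ ρ′ → ρ ≡ s ∷ ρ′ × ρ′ ↭ T × Linked _<_ (s ∷ laterRunHeads s ρ′) ×
                                 valleys ρ + risesFrom s ρ′ ≡ k
TailOf-shape s k       []      ρ _      (refl , refl)   = [] , refl , ↭-refl , [-] , refl
TailOf-shape s (suc k) (t ∷ T) ρ sorted (p , flat , v)
  with flattened-starts-least s (t ∷ T) ρ sorted p flat
... | ρ′ , refl , s<ρ′ = ρ′ , refl , drop-∷ p , to (Flattened-∷ s ρ′) flat , (begin
  valleys (s ∷ ρ′) + risesFrom s ρ′ ≡⟨ cong (valleys (s ∷ ρ′) +_) (risesFrom-↭ s<ρ′ (drop-∷ p)) ⟩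
  valleys (s ∷ ρ′) + 1              ≡⟨ +-comm (valleys (s ∷ ρ′)) 1 ⟩
  suc (valleys (s ∷ ρ′))            ≡⟨ cong suc v ⟩
  suc k                             ∎)
  where open ≡-Reasoning

TailOf-intro : ∀ s k T ρ′ → ρ′ ↭ T → Linked _<_ (s ∷ laterRunHeads s ρ′) →
               valleys (s ∷ ρ′) + risesFrom s ρ′ ≡ k → TailOf s k T (s ∷ ρ′)
TailOf-intro s k []      ρ′ p _ v with ↭-empty-inv p
... | refl = refl , sym v
TailOf-intro s k (t ∷ T) ρ′ p heads v
  rewrite risesFrom-↭ (laterRunHeads-above {s} ρ′ ≤-refl heads) p
        | +-comm (valleys (s ∷ ρ′)) 1 with k | v
... | zero  | ()
... | suc _ | refl = ↭-prep s p , from (Flattened-∷ s ρ′) heads , refl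

-- If every entry of ys is at least s₂ < p, the first run of p ∷ ys reaches s₂: a run starting
-- before s₂ would have its head above s₂, while all entries after a run head lie above it.
run-until-least : ∀ {s₁ s₂} p ys → s₂ < p → s₂ ∈ ys → All (s₂ ≤_) ys →
                  Linked _<_ (s₁ ∷ laterRunHeads p ys) →
                  Σ (List ℕ) λ A → Σ (List ℕ) λ ρ → ys ≡ A ++ s₂ ∷ ρ × Linked _<_ (p ∷ A) ×
                                                   s₂ < lastOf p A × Linked _<_ (s₂ ∷ laterRunHeads s₂ ρ)
run-until-least {s₁} {s₂} p (z ∷ zs) s₂<p s₂∈ (s₂≤z ∷ s₂≤zs) heads with z ≟ s₂
... | yes refl =
  [] , zs , refl , [-] , s₂<p ,
  Linked.tail (subst (Linked _<_ ∘ (s₁ ∷_)) (laterRunHeads-descent zs (<⇒≯ s₂<p)) heads)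
... | no z≢s₂ with s₂∈ | p <? z
...   | here s₂≡z  | _       = ⊥-elim (z≢s₂ (sym s₂≡z))
...   | there s₂∈zs | no p≮z =
  ⊥-elim (<-asym s₂<z (All.lookup z<zs s₂∈zs))
  where
  s₂<z = ≤∧≢⇒< s₂≤z (z≢s₂ ∘ sym)
  z<zs = laterRunHeads-above zs ≤-refl
           (Linked.tail (subst (Linked _<_ ∘ (s₁ ∷_)) (laterRunHeads-descent zs p≮z) heads))
...   | there s₂∈zs | yes p<z
  with run-until-least z zs (≤∧≢⇒< s₂≤z (z≢s₂ ∘ sym)) s₂∈zs s₂≤zs
         (subst (Linked _<_ ∘ (s₁ ∷_)) (laterRunHeads-ascent zs p<z) heads)
... | A , ρ , refl , run , s₂<last , heads′ = z ∷ A , ρ , refl , p<z ∷ run , s₂<last , heads′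

prefix-unique : ∀ {s : ℕ} A A′ {ρ ρ′} → s ∉ A → s ∉ A′ → A ++ s ∷ ρ ≡ A′ ++ s ∷ ρ′ → A ≡ A′
prefix-unique []      []       _   _    _  = refl
prefix-unique []      (_ ∷ _)  _   s∉A′ eq = ⊥-elim (s∉A′ (here (∷-injectiveˡ eq)))
prefix-unique (_ ∷ _) []       s∉A _    eq = ⊥-elim (s∉A (here (sym (∷-injectiveˡ eq))))
prefix-unique (a ∷ A) (a′ ∷ A′) s∉A s∉A′ eq =
  cong₂ _∷_ (∷-injectiveˡ eq) (prefix-unique A A′ (s∉A ∘ there) (s∉A′ ∘ there) (∷-injectiveʳ eq))

SplitArrangement : ℕ → ℕ → ℕ → Split → List ℕ → Set
SplitArrangement s₁ s₂ k (A , T) π = Σ (List ℕ) λ ρ → TailOf s₂ k T ρ × π ≡ s₁ ∷ A ++ ρ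

LeastAdjacent : ℕ → ℕ → List ℕ → ℕ → List ℕ → Set
LeastAdjacent s₁ s₂ R k π = Σ (List ℕ) λ σ → FlatArrangement (s₁ ∷ R) k σ × π ≡ insertSecond s₂ σ

LeastSeparated : ℕ → ℕ → List ℕ → ℕ → List ℕ → Set
LeastSeparated s₁ s₂ R k π = Σ Split λ i → i ∈ splits⁺ R × SplitArrangement s₁ s₂ k i π

module Decomposition {s₁ s₂ : ℕ} {R : List ℕ} (sorted : Sorted (s₁ ∷ s₂ ∷ R)) where

  s₁<s₂ : s₁ < s₂
  s₁<s₂ = All.head (AllPairs.head sorted)

  s₂<R : All (s₂ <_) R
  s₂<R = AllPairs.head (AllPairs.tail sorted)

  sortedR : Sorted R
  sortedR = AllPairs.tail (AllPairs.tail sorted)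

  sorted₁R : Sorted (s₁ ∷ R)
  sorted₁R = All.tail (AllPairs.head sorted) ∷ sortedR

  sorted-parts : ∀ {A T} → (A , T) ∈ splits R → Sorted (s₂ ∷ A) × Sorted (s₂ ∷ T)
  sorted-parts i∈ with All-splits R s₂<R i∈ | splits-sorted R sortedR i∈
  ... | s₂<A , s₂<T | sortedA , sortedT = s₂<A ∷ sortedA , s₂<T ∷ sortedT

  tail-≥s₂ : ∀ {ys} → s₁ ∷ ys ↭ s₁ ∷ s₂ ∷ R → All (s₁ <_) ys → All (s₂ ≤_) ys
  tail-≥s₂ p s₁<ys = All.tabulate λ z∈ → ≥s₂ (∈-resp-↭ p (there z∈)) (All.lookup s₁<ys z∈)
    where
    ≥s₂ : ∀ {z} → z ∈ s₁ ∷ s₂ ∷ R → s₁ < z → s₂ ≤ z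
    ≥s₂ (here refl)          s₁<s₁ = ⊥-elim (<-irrefl refl s₁<s₁)
    ≥s₂ (there (here refl))  _     = ≤-refl
    ≥s₂ (there (there z∈R))  _     = <⇒≤ (All.lookup s₂<R z∈R)

  FlatArrangement-skip : ∀ k ys →
    FlatArrangement (s₁ ∷ s₂ ∷ R) k (s₁ ∷ s₂ ∷ ys) ⇔ FlatArrangement (s₁ ∷ R) k (s₁ ∷ ys)
  FlatArrangement-skip k ys = mk⇔
    (λ (p , flat , v) → let s₂<ys′ = s₂<ys (drop-∷ (drop-∷ p)) in
       ↭-prep s₁ (drop-∷ (drop-∷ p)) , to (Flattened-skip s₁<s₂ ys s₂<ys′) flat ,
       trans (sym (valleys-skip s₁<s₂ ys s₂<ys′)) v)
    (λ (p , flat , v) → let s₂<ys′ = s₂<ys (drop-∷ p) in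
       ↭-prep s₁ (↭-prep s₂ (drop-∷ p)) , from (Flattened-skip s₁<s₂ ys s₂<ys′) flat ,
       trans (valleys-skip s₁<s₂ ys s₂<ys′) v)
    where
    s₂<ys : ys ↭ R → All (s₂ <_) ys
    s₂<ys ys↭R = All-resp-↭ (↭-sym ys↭R) s₂<R

  second-∈ : ∀ {y ys} → y ≢ s₂ → s₂ ∈ s₁ ∷ y ∷ ys → s₂ ∈ ys
  second-∈ _    (here s₂≡s₁)         = ⊥-elim (<-irrefl (sym s₂≡s₁) s₁<s₂)
  second-∈ y≢s₂ (there (here s₂≡y))  = ⊥-elim (y≢s₂ (sym s₂≡y))
  second-∈ _    (there (there s₂∈ys)) = s₂∈ys

  separate : ∀ k y ys → FlatArrangement (s₁ ∷ s₂ ∷ R) k (s₁ ∷ y ∷ ys) → All (s₁ <_) (y ∷ ys) → y ≢ s₂ →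
             LeastSeparated s₁ s₂ R k (s₁ ∷ y ∷ ys)
  separate k y ys (p , flat , v) (s₁<y ∷ s₁<ys) y≢s₂ with tail-≥s₂ p (s₁<y ∷ s₁<ys)
  ... | s₂≤y ∷ s₂≤ys
    with run-until-least y ys (≤∧≢⇒< s₂≤y (y≢s₂ ∘ sym))
           (second-∈ y≢s₂ (∈-resp-↭ (↭-sym p) (there (here refl)))) s₂≤ys
           (subst (Linked _<_ ∘ (s₁ ∷_)) (laterRunHeads-ascent ys s₁<y) (to (Flattened-∷ s₁ (y ∷ ys)) flat))
  ... | A , ρ′ , refl , run , s₂<last , heads
    with sorted-sublist-∈-splits R (y ∷ A) ρ′ sortedR (Linked⇒AllPairs <-trans run)
           (drop-∷ (↭-trans (↭-sym (shift s₂ (y ∷ A) ρ′)) (drop-∷ p)))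
  ... | T , i∈ , ρ′↭T =
    (y ∷ A , T) , splits⇒splits⁺ R i∈ , s₂ ∷ ρ′ ,
    TailOf-intro s₂ k T ρ′ ρ′↭T heads (trans (sym (valleys-run-++ s₁ (y ∷ A) s₂ ρ′ (s₁<y ∷ run) s₂<last)) v) ,
    refl

  classify : ∀ k π → FlatArrangement (s₁ ∷ s₂ ∷ R) k π →
             LeastAdjacent s₁ s₂ R k π ⊎ LeastSeparated s₁ s₂ R k π
  classify k π (p , flat , v) with flattened-starts-least s₁ (s₂ ∷ R) π sorted p flat
  ... | [] , refl , _ with ∈-resp-↭ (↭-sym p) (there (here refl))
  ...   | here s₂≡s₁ = ⊥-elim (<-irrefl (sym s₂≡s₁) s₁<s₂)
  classify k π (p , flat , v) | y ∷ ys , refl , s₁<yys with y ≟ s₂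
  ... | yes refl = inj₁ (s₁ ∷ ys , to (FlatArrangement-skip k ys) (p , flat , v) , refl)
  ... | no y≢s₂  = inj₂ (separate k y ys (p , flat , v) s₁<yys y≢s₂)

  unskip : ∀ k π → LeastAdjacent s₁ s₂ R k π → FlatArrangement (s₁ ∷ s₂ ∷ R) k π
  unskip k π (σ , (p , flat , v) , refl) with flattened-starts-least s₁ R σ sorted₁R p flat
  ... | σ′ , refl , _ = from (FlatArrangement-skip k σ′) (p , flat , v)

  merge : ∀ k π → LeastSeparated s₁ s₂ R k π → FlatArrangement (s₁ ∷ s₂ ∷ R) k π
  merge k π ((A , T) , i∈⁺ , ρ , tail , refl) with splits⁺-nonempty R i∈⁺
  ... | a , A′ , refl with sorted-parts (splits⁺⊆splits R i∈⁺)
  ... | s₂<aA′ ∷ sortedA , sortedT with TailOf-shape s₂ k T ρ sortedT tail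
  ... | ρ′ , refl , ρ′↭T , heads , v =
    arrangement , flat , trans (valleys-run-++ s₁ (a ∷ A′) s₂ ρ′ run s₂<last) v
    where
    arrangement : s₁ ∷ (a ∷ A′) ++ s₂ ∷ ρ′ ↭ s₁ ∷ s₂ ∷ R
    arrangement = ↭-prep s₁ (↭-trans (shift s₂ (a ∷ A′) ρ′)
                    (↭-prep s₂ (↭-trans (++⁺ˡ (a ∷ A′) ρ′↭T) (splits-↭ R (splits⁺⊆splits R i∈⁺)))))
    run : Linked _<_ (s₁ ∷ a ∷ A′)
    run = <-trans s₁<s₂ (All.head s₂<aA′) ∷ AllPairs⇒Linked sortedA
    s₂<last : s₂ < lastOf a A′
    s₂<last = All.lookup s₂<aA′ (lastOf-∈ a A′)
    flat : Flattened (s₁ ∷ (a ∷ A′) ++ s₂ ∷ ρ′)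
    flat = from (Flattened-∷ s₁ ((a ∷ A′) ++ s₂ ∷ ρ′))
      (subst (Linked _<_ ∘ (s₁ ∷_))
             (sym (trans (laterRunHeads-++ s₁ (a ∷ A′) (s₂ ∷ ρ′) run)
                         (laterRunHeads-descent ρ′ (<⇒≯ s₂<last))))
             (s₁<s₂ ∷ heads))

  decomposition : ∀ k π →
    (LeastAdjacent s₁ s₂ R k π ⊎ LeastSeparated s₁ s₂ R k π) ⇔ FlatArrangement (s₁ ∷ s₂ ∷ R) k π
  decomposition k π =
    mk⇔ (λ { (inj₁ adj) → unskip k π adj ; (inj₂ sep) → merge k π sep }) (classify k π)

  adjacent-separated-disjoint : ∀ k π → LeastAdjacent s₁ s₂ R k π → ¬ LeastSeparated s₁ s₂ R k π
  adjacent-separated-disjoint k π (σ , (p , flat , _) , refl) ((A , T) , i∈⁺ , _ , _ , eq)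
    with flattened-starts-least s₁ R σ sorted₁R p flat | splits⁺-nonempty R i∈⁺
  ... | σ′ , refl , _ | a , A′ , refl =
    <-irrefl (∷-injectiveˡ (∷-injectiveʳ eq)) (All.head (proj₁ (All-splits R s₂<R (splits⁺⊆splits R i∈⁺))))

  splitArrangements-disjoint : ∀ k i j π → i ∈ splits⁺ R → j ∈ splits⁺ R →
                               SplitArrangement s₁ s₂ k i π → SplitArrangement s₁ s₂ k j π → i ≡ j
  splitArrangements-disjoint k (A , T) (A′ , T′) π i∈⁺ j∈⁺ (ρ , tail , refl) (ρ₂ , tail₂ , eq)
    with sorted-parts (splits⁺⊆splits R i∈⁺) | sorted-parts (splits⁺⊆splits R j∈⁺)
  ... | s₂<A ∷ _ , sortedT | s₂<A′ ∷ _ , sortedT′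
    with TailOf-shape s₂ k T ρ sortedT tail | TailOf-shape s₂ k T′ ρ₂ sortedT′ tail₂
  ... | ρ′ , refl , _ | ρ₂′ , refl , _ with prefix-unique A A′ (<-∉ s₂<A) (<-∉ s₂<A′) (∷-injectiveʳ eq)
  ... | refl =
    cong (A ,_) (splits-second-unique R sortedR (splits⁺⊆splits R i∈⁺) (splits⁺⊆splits R j∈⁺))

sum-map-applyUpTo : ∀ (h f : ℕ → ℕ) n → sum (map h (applyUpTo f n)) ≡ ∑[ i < n ] h (f (toℕ i))
sum-map-applyUpTo h f zero    = refl
sum-map-applyUpTo h f (suc n) = cong (h (f 0) +_) (sum-map-applyUpTo h (f ∘ suc) n)

tailCount : ℕ → ℕ → ℕ
tailCount zero    zero    = 1
tailCount zero    (suc j) = 0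
tailCount (suc k) zero    = 0
tailCount (suc k) (suc j) = bRow k (suc j)

bRow-suc : ∀ k m → bRow k (suc m) ≡ bRow k m + properBinomialSum m (tailCount k)
bRow-suc zero    zero    = refl
bRow-suc zero    (suc n) = begin
  suc (suc n)                     ≡⟨ +-comm 1 (suc n) ⟩
  suc n + 1                       ≡⟨ cong (λ s → suc n + (1 + s)) vanishing ⟨
  bRow zero (suc n) + properBinomialSum (suc n) (tailCount zero) ∎
  where
  open ≡-Reasoning
  vanishing : ∑[ j < n ] binomialTerm (suc n) (tailCount zero) (suc (toℕ j)) ≡ 0
  vanishing = trans (sum-cong-≗ {n} (λ j → *-zeroʳ (suc n C suc (toℕ j)))) (sum-replicate-zero n)
bRow-suc (suc k) zero    = refl
bRow-suc (suc k) (suc n) = cong (bRow (suc k) (suc n) +_) (begin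
  sum (map (λ i → (suc n C i) * bRow k i) (map suc (upTo n)))
    ≡⟨ cong (sum ∘ map (λ i → (suc n C i) * bRow k i)) (map-applyUpTo id suc n) ⟩
  sum (map (λ i → (suc n C i) * bRow k i) (applyUpTo suc n))
    ≡⟨ sum-map-applyUpTo _ suc n ⟩
  ∑[ j < n ] binomialTerm (suc n) (tailCount (suc k)) (suc (toℕ j)) ∎)
  where open ≡-Reasoning

TailOf-count : ∀ s k T → (∀ k′ → NumberOf (FlatArrangement (s ∷ T) k′) (bRow k′ (length T))) →
               NumberOf (TailOf s k T) (tailCount k (length T))
TailOf-count s zero    []      _     = NumberOf-resp-⇔ (λ π → mk⇔ (_, refl) proj₁) (NumberOf-≡ (s ∷ []))
TailOf-count s (suc k) []      _     = NumberOf-∅ λ { π (_ , ()) }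
TailOf-count s zero    (_ ∷ _) _     = NumberOf-∅ λ π ()
TailOf-count s (suc k) (_ ∷ _) count = count k

splits-second-≤ : ∀ R {A T} → (A , T) ∈ splits R → length T ≤ length R
splits-second-≤ R {A} {T} i∈ = begin
  length T            ≤⟨ m≤n+m (length T) (length A) ⟩
  length A + length T ≡⟨ length-++ A ⟨
  length (A ++ T)     ≡⟨ ↭-length (splits-↭ R i∈) ⟩
  length R            ∎
  where open ≤-Reasoning

FlatArrangementCount : ℕ → Set
FlatArrangementCount m =
  ∀ {s S} k → length S ≡ m → Sorted (s ∷ S) → NumberOf (FlatArrangement (s ∷ S) k) (bRow k m)

FlatArrangement-count : ∀ m → FlatArrangementCount m
FlatArrangement-count = <-rec FlatArrangementCount count
  where
  count : ∀ m → (∀ {j} → j < m → FlatArrangementCount j) → FlatArrangementCount m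
  count _ _ {s} {[]} zero refl _ =
    NumberOf-resp-⇔ (λ π → mk⇔ (λ { refl → ↭-refl , [-] , refl }) (↭-singleton-inv ∘ proj₁))
                    (NumberOf-≡ (s ∷ []))
  count _ _ {s} {[]} (suc k) refl _ =
    NumberOf-∅ λ { π (p , _ , v) → contradiction (trans (cong valleys (sym (↭-singleton-inv p))) v) λ () }
  count _ rec {s₁} {s₂ ∷ R} k refl sorted =
    subst (NumberOf _) (sym recurrence)
      (NumberOf-resp-⇔ (decomposition k) (NumberOf-⊎ (adjacent-separated-disjoint k) adjacent separated))
    where
    open Decomposition sorted
    recurrence : bRow k (suc (length R)) ≡
                 bRow k (length R) + sum (map (sizeOfSecond (tailCount k)) (splits⁺ R))
    recurrence =
      trans (bRow-suc k (length R)) (cong (bRow k (length R) +_) (sym (sum-splits⁺ R (tailCount k))))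
    adjacent : NumberOf (LeastAdjacent s₁ s₂ R k) (bRow k (length R))
    adjacent = NumberOf-image (insertSecond s₂) (insertSecond-injective s₂) (rec ≤-refl k refl sorted₁R)
    through : ∀ i → i ∈ splits⁺ R → NumberOf (SplitArrangement s₁ s₂ k i) (sizeOfSecond (tailCount k) i)
    through (A , T) i∈⁺ =
      NumberOf-image (λ ρ → s₁ ∷ A ++ ρ) (++-cancelˡ A _ _ ∘ ∷-injectiveʳ)
        (TailOf-count s₂ k T λ k′ → rec (s≤s (splits-second-≤ R i∈)) k′ refl (proj₂ (sorted-parts i∈)))
      where i∈ = splits⁺⊆splits R i∈⁺
    separated : NumberOf (LeastSeparated s₁ s₂ R k) (sum (map (sizeOfSecond (tailCount k)) (splits⁺ R)))
    separated = NumberOf-⋃ (SplitArrangement s₁ s₂ k) (sizeOfSecond (tailCount k)) (splits⁺ R)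
                           (splits⁺-unique R sortedR) (splitArrangements-disjoint k) through

Sorted-map-suc-upTo : ∀ m → Sorted (map suc (upTo m))
Sorted-map-suc-upTo m = AllPairs.map⁺ (AllPairs.applyUpTo⁺₁ id m λ i<j _ → s≤s i<j)

-- The count holds for all n and k.
corollary3p2 : NumberOf (FlatVal 0 0) 1 × ((n k : ℕ) → 1 ≤ n → 1 ≤ k → NumberOf (FlatVal (suc n) k) (b n k))
corollary3p2 = empty-permutation , λ n k _ _ →
  FlatArrangement-count n k (trans (length-map suc (applyUpTo suc n)) (length-applyUpTo suc n))
                            (Sorted-map-suc-upTo (suc n))
  where
  empty-permutation : NumberOf (FlatVal 0 0) 1
  empty-permutation =
    NumberOf-resp-⇔ (λ π → mk⇔ (λ { refl → ↭-refl , [] , refl }) (↭-empty-inv ∘ proj₁)) (NumberOf-≡ [])
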